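{- Let $0\le a\le n$ with $2\mid(n-a)$. Let $w=(i_1,j_1)(i_2,j_2)\cdots(i_d,j_d)\in\mathfrak{S}_n$ be an involution with exactly $d$ two-cycles, and let $1\le p\le n$ with $p>n-2d+a$. Then $\eta_p\cdot\mathfrak{m}(w)\in I^{\mathcal{M}}_{n,a}$.
   Context: $\mathbf{x}_{n\times n}=(x_{i,j})$ is a matrix of variables; $\mathfrak{S}_n$ acts on $\mathbb{C}[\mathbf{x}_{n\times n}]$ by $v\cdot x_{i,j}=x_{v(i),v(j)}$, and $\eta_p=\sum_{v\in\mathfrak{S}_p}v\in\mathbb{C}[\mathfrak{S}_n]$ where $\mathfrak{S}_p$ permutes the first $p$ letters. For an involution $w$, $\mathfrak{m}(w)=\prod_{i<j,\,w(i)=j}x_{i,j}$. $I^{\mathcal{M}}_{n,a}$ is the ideal generated by all row sums $x_{i,1}+\cdots+x_{i,n}$, all column sums $x_{1,j}+\cdots+x_{n,j}$, all products $x_{i,j}x_{i,j'}$ and $x_{i,j}x_{i',j}$, all differences $x_{i,j}-x_{j,i}$, the diagonal sum $x_{1,1}+\cdots+x_{n,n}$, and all products $\prod_{i\in S}x_{i,i}$ with $S\subseteq[n]$, $|S|>a$. -}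

module Defs where

open import Data.Bool using (Bool; true; false; if_then_else_)
open import Data.Nat as ℕ using (ℕ; zero; suc)
import Data.Nat.Properties as ℕP
open import Data.Fin using (Fin; zero; suc; toℕ; fromℕ<; inject≤)
open import Data.Fin.Properties using (_≟_; _<?_)
open import Data.Fin.Subset using (Subset; ∣_∣)
open import Data.List using (List; []; _∷_; [_]; map; foldr; concatMap; filter; length; allFin)
open import Data.List.Relation.Unary.All using (All)
open import Data.Product using (_×_; _,_; Σ; proj₁; proj₂)
open import Data.Rational using (ℚ; 0ℚ; 1ℚ) renaming (_+_ to _+ℚ_; _*_ to _*ℚ_)
open import Data.Vec using (lookup)
open import Function using (_∘_; id)
open import Relation.Nullary using (does)

-- The polynomial ring ℚ[V] as the free commutative ℚ-algebra on V:
-- syntactic expressions modulo the least congruence containing the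
-- commutative ring axioms and making  con : ℚ → ℚ[V]  a ring map.

infixl 6 _⊕_
infixl 7 _⊗_
infix 4 _≈_

data Expr (V : Set) : Set where
  con : ℚ → Expr V
  var : V → Expr V
  _⊕_ : Expr V → Expr V → Expr V
  _⊗_ : Expr V → Expr V → Expr V
  ⊖_  : Expr V → Expr V

data _≈_ {V : Set} : Expr V → Expr V → Set where
  ≈-refl  : ∀ {x} → x ≈ x
  ≈-sym   : ∀ {x y} → x ≈ y → y ≈ x
  ≈-trans : ∀ {x y z} → x ≈ y → y ≈ z → x ≈ z
  ⊕-cong  : ∀ {x x' y y'} → x ≈ x' → y ≈ y' → x ⊕ y ≈ x' ⊕ y'
  ⊗-cong  : ∀ {x x' y y'} → x ≈ x' → y ≈ y' → x ⊗ y ≈ x' ⊗ y'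
  ⊖-cong  : ∀ {x x'} → x ≈ x' → ⊖ x ≈ ⊖ x'
  ⊕-assoc : ∀ x y z → (x ⊕ y) ⊕ z ≈ x ⊕ (y ⊕ z)
  ⊕-comm  : ∀ x y → x ⊕ y ≈ y ⊕ x
  ⊕-idˡ   : ∀ x → con 0ℚ ⊕ x ≈ x
  ⊖-invʳ  : ∀ x → x ⊕ (⊖ x) ≈ con 0ℚ
  ⊗-assoc : ∀ x y z → (x ⊗ y) ⊗ z ≈ x ⊗ (y ⊗ z)
  ⊗-comm  : ∀ x y → x ⊗ y ≈ y ⊗ x
  ⊗-idˡ   : ∀ x → con 1ℚ ⊗ x ≈ x
  distribˡ : ∀ x y z → x ⊗ (y ⊕ z) ≈ (x ⊗ y) ⊕ (x ⊗ z)
  con-+   : ∀ p q → con (p +ℚ q) ≈ con p ⊕ con q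
  con-*   : ∀ p q → con (p *ℚ q) ≈ con p ⊗ con q

rename : {V W : Set} → (V → W) → Expr V → Expr W
rename f (con q) = con q
rename f (var v) = var (f v)
rename f (x ⊕ y) = rename f x ⊕ rename f y
rename f (x ⊗ y) = rename f x ⊗ rename f y
rename f (⊖ x)   = ⊖ rename f x

sumE : {V : Set} → List (Expr V) → Expr V
sumE = foldr _⊕_ (con 0ℚ)

prodE : {V : Set} → List (Expr V) → Expr V
prodE = foldr _⊗_ (con 1ℚ)

Var : ℕ → Set
Var n = Fin n × Fin n

x : ∀ {n} → Fin n → Fin n → Expr (Var n)
x i j = var (i , j)

act : ∀ {n} → (Fin n → Fin n) → Expr (Var n) → Expr (Var n)
act v = rename (λ ij → v (proj₁ ij) , v (proj₂ ij))

IsInvolution : ∀ {n} → (Fin n → Fin n) → Set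
IsInvolution {n} w = ∀ (i : Fin n) → w (w i) ≡ i
  where open import Relation.Binary.PropositionalEquality using (_≡_)

twoCycles : ∀ {n} → (Fin n → Fin n) → ℕ
twoCycles {n} w = length (filter (λ i → i <? w i) (allFin n))

𝔪 : ∀ {n} → (Fin n → Fin n) → Expr (Var n)
𝔪 {n} w = prodE (map (λ i → x i (w i)) (filter (λ i → i <? w i) (allFin n)))

-- Enumeration of 𝔖_p (each permutation listed exactly once)

swap0 : ∀ {p} → Fin (suc p) → Fin (suc p) → Fin (suc p)
swap0 k i with does (i ≟ k) | does (i ≟ zero)
... | true  | _     = zero
... | false | true  = k
... | false | false = i

ext0 : ∀ {p} → (Fin p → Fin p) → Fin (suc p) → Fin (suc p)
ext0 σ zero    = zero
ext0 σ (suc i) = suc (σ i)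

perms : (p : ℕ) → List (Fin p → Fin p)
perms zero    = [ id ]
perms (suc p) = concatMap (λ k → map (λ σ → swap0 k ∘ ext0 σ) (perms p)) (allFin (suc p))

embed : ∀ {p n} → p ℕ.≤ n → (Fin p → Fin p) → Fin n → Fin n
embed {p} p≤n σ i with toℕ i ℕ.<? p
... | Relation.Nullary.yes i<p = inject≤ (σ (fromℕ< i<p)) p≤n
... | Relation.Nullary.no  _   = i

η· : ∀ {n} (p : ℕ) → p ℕ.≤ n → Expr (Var n) → Expr (Var n)
η· p p≤n f = sumE (map (λ σ → act (embed p≤n σ) f) (perms p))

diagProd : ∀ {n} → Subset n → Expr (Var n)
diagProd {n} S = prodE (map (λ i → if lookup S i then x i i else con 1ℚ) (allFin n))

data Gen (n a : ℕ) : Expr (Var n) → Set where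
  rowSum  : ∀ i → Gen n a (sumE (map (λ j → x i j) (allFin n)))
  colSum  : ∀ j → Gen n a (sumE (map (λ i → x i j) (allFin n)))
  rowProd : ∀ i j j' → Gen n a (x i j ⊗ x i j')
  colProd : ∀ i i' j → Gen n a (x i j ⊗ x i' j)
  symDiff : ∀ i j → Gen n a (x i j ⊕ (⊖ x j i))
  diagSum : Gen n a (sumE (map (λ i → x i i) (allFin n)))
  diagBig : ∀ (S : Subset n) → a ℕ.< ∣ S ∣ → Gen n a (diagProd S)

InIdeal : (n a : ℕ) → Expr (Var n) → Set
InIdeal n a f =
  Σ (List (Expr (Var n) × Expr (Var n))) λ L →
    All (λ hg → Gen n a (proj₂ hg)) L ×
    (f ≈ sumE (map (λ hg → proj₁ hg ⊗ proj₂ hg) L))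

{-# OPTIONS --safe #-}
-- η_p is built one letter at a time: summing over the permutations of a window of letters
-- c = ι 0, ι 1, …, ι q is summing over those of ι 1, …, ι q and then over the q + 1
-- transpositions (c ι k).  Work modulo the ideal I₀ generated by the row, column and diagonal
-- sums, the products of two entries of a row or of a column and the differences
-- x_{ij} − x_{ji}; modulo I₀ a product of two variables sharing an index vanishes.  By
-- induction on the window, the symmetrisation of a monomial of degree d is congruent to a
-- combination of degree-d monomials with no index in the window: if a monomial contains c
-- exactly once, summing over the transpositions replaces c by each letter of the window,
-- which is a row, column or diagonal sum minus the replacements of c by letters outside the
-- window.  In the end every monomial has d factors on the n − p letters outside {1, …, p};
-- unless two factors share an index, at least 2d − (n − p) > a of them are diagonal, and
-- their product is a generator ∏_{i∈S} x_{i,i} with |S| > a.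
module Submission where

open import Defs
open import Level using (0ℓ)
open import Data.Bool using (if_then_else_)
open import Data.Nat as ℕ using (ℕ; zero; suc; _≤_; _<_; _+_; _*_; _∸_)
import Data.Nat.Properties as ℕ
open import Data.Nat.Divisibility using (_∣_)
open import Data.Fin using (Fin; zero; suc; toℕ; fromℕ<; inject≤)
open import Data.Fin.Properties
  using (_≟_; _<?_; any?; suc-injective; toℕ-injective; toℕ-fromℕ<; toℕ-inject≤; inject≤-injective; toℕ<n)
open import Data.Fin.Permutation as Perm using (Permutation; _⟨$⟩ʳ_)
open import Data.Fin.Permutation.Components using (transpose)
open import Data.Fin.Subset using (Subset; ∣_∣; inside; outside; ⊥)
open import Data.Fin.Subset.Properties using (∣p∣≤n; ∣⊥∣≡0)
open import Data.List as List using (List; []; _∷_; map; tabulate; allFin; concatMap; _++_; length; filter)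
import Data.List.Properties as List
open import Data.List.Relation.Unary.All using (All; []; _∷_; universal) renaming (map to All-map; zipWith to All-zipWith)
open import Data.List.Relation.Unary.All.Properties using (++⁺; map⁺; ¬Any⇒All¬)
open import Data.List.Relation.Unary.Any using (Any; here; there)
import Data.List.Relation.Unary.Any as Any
open import Data.List.Relation.Unary.Any.Properties using () renaming (map⁺ to Any-map⁺)
open import Data.Product using (Σ; ∃-syntax; _×_; _,_; proj₁; proj₂)
open import Data.Rational using (0ℚ; 1ℚ)
import Data.Rational as ℚ
import Data.Rational.Properties as ℚ
open import Data.Sum using (_⊎_; inj₁; inj₂; [_,_]′)
open import Data.Vec using (lookup; _[_]≔_)
import Data.Vec as Vec
open import Data.Vec.Properties using (lookup∘update; lookup∘update′; lookup-replicate; lookup∘tabulate)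
open import Data.Empty using (⊥-elim)
open import Data.Maybe using (Maybe; just; nothing)
open import Function using (_∘_; id; case_of_)
open import Function.Definitions using (Injective)
open import Relation.Binary.PropositionalEquality as ≡ using (_≡_; _≢_; refl; cong; cong₂)
open import Relation.Nullary using (Dec; yes; no; does; ¬_)
open import Relation.Nullary.Decidable using (dec-true; dec-false; _⊎-dec_)
open import Algebra.Bundles using (CommutativeRing)
open import Algebra.Structures using (IsCommutativeRing)
open import Relation.Binary.Structures using (IsEquivalence)

module _ {V W : Set} where

  rename-cong : (ρ : V → W) {f g : Expr V} → f ≈ g → rename ρ f ≈ rename ρ g
  rename-cong ρ ≈-refl             = ≈-refl
  rename-cong ρ (≈-sym e)          = ≈-sym (rename-cong ρ e)
  rename-cong ρ (≈-trans e e′)     = ≈-trans (rename-cong ρ e) (rename-cong ρ e′)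
  rename-cong ρ (⊕-cong e e′)      = ⊕-cong (rename-cong ρ e) (rename-cong ρ e′)
  rename-cong ρ (⊗-cong e e′)      = ⊗-cong (rename-cong ρ e) (rename-cong ρ e′)
  rename-cong ρ (⊖-cong e)         = ⊖-cong (rename-cong ρ e)
  rename-cong ρ (⊕-assoc f g h)    = ⊕-assoc _ _ _
  rename-cong ρ (⊕-comm f g)       = ⊕-comm _ _
  rename-cong ρ (⊕-idˡ f)          = ⊕-idˡ _
  rename-cong ρ (⊖-invʳ f)         = ⊖-invʳ _
  rename-cong ρ (⊗-assoc f g h)    = ⊗-assoc _ _ _
  rename-cong ρ (⊗-comm f g)       = ⊗-comm _ _
  rename-cong ρ (⊗-idˡ f)          = ⊗-idˡ _
  rename-cong ρ (distribˡ f g h)   = distribˡ _ _ _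
  rename-cong ρ (con-+ p q)        = con-+ p q
  rename-cong ρ (con-* p q)        = con-* p q

  rename-≗ : {ρ ρ′ : V → W} → (∀ v → ρ v ≡ ρ′ v) → (f : Expr V) → rename ρ f ≡ rename ρ′ f
  rename-≗ eq (con q) = refl
  rename-≗ eq (var v) = cong var (eq v)
  rename-≗ eq (f ⊕ g) = cong₂ _⊕_ (rename-≗ eq f) (rename-≗ eq g)
  rename-≗ eq (f ⊗ g) = cong₂ _⊗_ (rename-≗ eq f) (rename-≗ eq g)
  rename-≗ eq (⊖ f)   = cong ⊖_ (rename-≗ eq f)

  rename-sumE : (ρ : V → W) (fs : List (Expr V)) → rename ρ (sumE fs) ≡ sumE (map (rename ρ) fs)
  rename-sumE ρ []       = refl
  rename-sumE ρ (f ∷ fs) = cong (rename ρ f ⊕_) (rename-sumE ρ fs)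

rename-∘ : {U V W : Set} (ρ : V → W) (ρ′ : U → V) (f : Expr U) → rename ρ (rename ρ′ f) ≡ rename (ρ ∘ ρ′) f
rename-∘ ρ ρ′ (con q) = refl
rename-∘ ρ ρ′ (var v) = refl
rename-∘ ρ ρ′ (f ⊕ g) = cong₂ _⊕_ (rename-∘ ρ ρ′ f) (rename-∘ ρ ρ′ g)
rename-∘ ρ ρ′ (f ⊗ g) = cong₂ _⊗_ (rename-∘ ρ ρ′ f) (rename-∘ ρ ρ′ g)
rename-∘ ρ ρ′ (⊖ f)   = cong ⊖_ (rename-∘ ρ ρ′ f)

rename-id : {V : Set} {ρ : V → V} → (∀ v → ρ v ≡ v) → (f : Expr V) → rename ρ f ≡ f
rename-id eq (con q) = refl
rename-id eq (var v) = cong var (eq v)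
rename-id eq (f ⊕ g) = cong₂ _⊕_ (rename-id eq f) (rename-id eq g)
rename-id eq (f ⊗ g) = cong₂ _⊗_ (rename-id eq f) (rename-id eq g)
rename-id eq (⊖ f)   = cong ⊖_ (rename-id eq f)

transpose-matchˡ : ∀ {n} (i j : Fin n) → transpose i j i ≡ j
transpose-matchˡ i j rewrite dec-true (i ≟ i) refl = refl

transpose-matchʳ : ∀ {n} (i j : Fin n) → transpose i j j ≡ i
transpose-matchʳ i j with j ≟ i
... | yes j≡i = j≡i
... | no _ rewrite dec-true (j ≟ j) refl = refl

transpose-other : ∀ {n} {i j k : Fin n} → k ≢ i → k ≢ j → transpose i j k ≡ k
transpose-other {i = i} {j} {k} k≢i k≢j rewrite dec-false (k ≟ i) k≢i | dec-false (k ≟ j) k≢j = refl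

transpose-natural : ∀ {p n} {ι : Fin p → Fin n} → Injective _≡_ _≡_ ι →
                    ∀ i j k → ι (transpose i j k) ≡ transpose (ι i) (ι j) (ι k)
transpose-natural {ι = ι} ι-inj i j k with k ≟ i
... | yes refl = ≡.sym (transpose-matchˡ (ι k) (ι j))
... | no k≢i with k ≟ j
...   | yes refl = ≡.sym (transpose-matchʳ (ι i) (ι k))
...   | no k≢j   = ≡.sym (transpose-other (k≢i ∘ ι-inj) (k≢j ∘ ι-inj))

swap0≗transpose : ∀ {p} (k i : Fin (suc p)) → swap0 k i ≡ transpose zero k i
swap0≗transpose k i with i ≟ k
... | yes refl = ≡.sym (transpose-matchʳ zero i)
... | no i≢k with i ≟ zero
...   | yes refl = refl
...   | no _ rewrite dec-false (i ≟ k) i≢k = refl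

Image : ∀ {p n} → (Fin p → Fin n) → Fin n → Set
Image ι i = ∃[ k ] ι k ≡ i

image? : ∀ {p n} (ι : Fin p → Fin n) i → Dec (Image ι i)
image? ι i = any? (λ k → ι k ≟ i)

-- Generalises embed (the case ι = inject≤) so that the recursion of perms, which
-- shifts the permuted letters by one, stays within the family.
extend : ∀ {p n} → (Fin p → Fin n) → (Fin p → Fin p) → Fin n → Fin n
extend ι σ i with image? ι i
... | yes (k , _) = ι (σ k)
... | no _        = i

extend-image : ∀ {p n} {ι : Fin p → Fin n} → Injective _≡_ _≡_ ι → ∀ σ k → extend ι σ (ι k) ≡ ι (σ k)
extend-image {ι = ι} ι-inj σ k with image? ι (ι k)
... | yes (k′ , ιk′≡ιk) = cong (ι ∘ σ) (ι-inj ιk′≡ιk)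
... | no ∉image         = ⊥-elim (∉image (k , refl))

extend-outside : ∀ {p n} {ι : Fin p → Fin n} σ {i} → ¬ Image ι i → extend ι σ i ≡ i
extend-outside {ι = ι} σ {i} ∉image with image? ι i
... | yes ∈image = ⊥-elim (∉image ∈image)
... | no _       = refl

extend-swap0-ext0 : ∀ {p n} {ι : Fin (suc p) → Fin n} → Injective _≡_ _≡_ ι → ∀ k σ i →
                    extend ι (swap0 k ∘ ext0 σ) i ≡ transpose (ι zero) (ι k) (extend (ι ∘ suc) σ i)
extend-swap0-ext0 {ι = ι} ι-inj k σ i with image? ι i
... | yes (zero , refl) = begin
  ι (swap0 k zero)                                   ≡⟨ cong ι (swap0≗transpose k zero) ⟩
  ι (transpose zero k zero)                          ≡⟨ cong ι (transpose-matchˡ zero k) ⟩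
  ι k                                                ≡⟨ transpose-matchˡ (ι zero) (ι k) ⟨
  transpose (ι zero) (ι k) (ι zero)                  ≡⟨ cong (transpose (ι zero) (ι k)) (extend-outside σ ι0∉) ⟨
  transpose (ι zero) (ι k) (extend (ι ∘ suc) σ (ι zero)) ∎
  where
    open ≡.≡-Reasoning
    ι0∉ : ¬ Image (ι ∘ suc) (ι zero)
    ι0∉ (k′ , ιk′≡ι0) = case ι-inj ιk′≡ι0 of λ ()
... | yes (suc m , refl) = begin
  ι (swap0 k (suc (σ m)))                            ≡⟨ cong ι (swap0≗transpose k (suc (σ m))) ⟩
  ι (transpose zero k (suc (σ m)))                   ≡⟨ transpose-natural ι-inj zero k (suc (σ m)) ⟩
  transpose (ι zero) (ι k) (ι (suc (σ m)))           ≡⟨ cong (transpose (ι zero) (ι k)) ι′σm ⟨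
  transpose (ι zero) (ι k) (extend (ι ∘ suc) σ (ι (suc m))) ∎
  where
    open ≡.≡-Reasoning
    ι′σm : extend (ι ∘ suc) σ (ι (suc m)) ≡ ι (suc (σ m))
    ι′σm = extend-image (suc-injective ∘ ι-inj) σ m
... | no i∉ = ≡.sym (≡.trans (cong (transpose (ι zero) (ι k)) (extend-outside σ (λ (k′ , e) → i∉ (suc k′ , e))))
                             (transpose-other (λ e → i∉ (zero , ≡.sym e)) (λ e → i∉ (k , ≡.sym e))))

inject≤-fromℕ< : ∀ {p n} {i : Fin n} (i<p : toℕ i < p) (p≤n : p ≤ n) → inject≤ (fromℕ< i<p) p≤n ≡ i
inject≤-fromℕ< i<p p≤n = toℕ-injective (≡.trans (toℕ-inject≤ _ p≤n) (toℕ-fromℕ< i<p))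

outside-inject≤ : ∀ {p n} (p≤n : p ≤ n) {i : Fin n} → ¬ Image (λ k → inject≤ k p≤n) i → p ≤ toℕ i
outside-inject≤ p≤n i∉ = ℕ.≮⇒≥ (λ i<p → i∉ (fromℕ< i<p , inject≤-fromℕ< i<p p≤n))

embed≗extend : ∀ {p n} (p≤n : p ≤ n) σ i → embed p≤n σ i ≡ extend (λ k → inject≤ k p≤n) σ i
embed≗extend {p} p≤n σ i with toℕ i ℕ.<? p
... | yes i<p = ≡.sym (≡.trans (cong (extend _ σ) (≡.sym (inject≤-fromℕ< i<p p≤n)))
                               (extend-image (inject≤-injective p≤n p≤n _ _) σ _))
... | no i≮p  = ≡.sym (extend-outside σ λ (k , ιk≡i) →
                  i≮p (≡.subst (_< p) (≡.trans (≡.sym (toℕ-inject≤ k p≤n)) (cong toℕ ιk≡i)) (toℕ<n k)))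

∣p[i]≔inside∣ : ∀ {m} (S : Subset m) i → lookup S i ≡ outside → ∣ S [ i ]≔ inside ∣ ≡ suc ∣ S ∣
∣p[i]≔inside∣ (outside Vec.∷ S) zero    _  = refl
∣p[i]≔inside∣ (outside Vec.∷ S) (suc i) eq = ∣p[i]≔inside∣ S i eq
∣p[i]≔inside∣ (inside  Vec.∷ S) (suc i) eq = cong suc (∣p[i]≔inside∣ S i eq)

∣p[i]≔outside∣ : ∀ {m} (S : Subset m) i → lookup S i ≡ inside → suc ∣ S [ i ]≔ outside ∣ ≡ ∣ S ∣
∣p[i]≔outside∣ (inside  Vec.∷ S) zero    _  = refl
∣p[i]≔outside∣ (outside Vec.∷ S) (suc i) eq = ∣p[i]≔outside∣ S i eq
∣p[i]≔outside∣ (inside  Vec.∷ S) (suc i) eq = cong suc (∣p[i]≔outside∣ S i eq)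

∣p∣≤n∸k : ∀ {m} k (S : Subset m) → (∀ i → lookup S i ≡ inside → k ≤ toℕ i) → ∣ S ∣ ≤ m ∸ k
∣p∣≤n∸k zero    S                 _     = ∣p∣≤n S
∣p∣≤n∸k (suc k) Vec.[]            _     = ℕ.z≤n
∣p∣≤n∸k (suc k) (inside  Vec.∷ S) large = case large zero refl of λ ()
∣p∣≤n∸k (suc k) (outside Vec.∷ S) large = ∣p∣≤n∸k k S (λ i Si → ℕ.≤-pred (large (suc i) Si))

replace : ∀ {n} → Fin n → Fin n → Fin n → Fin n
replace c t u = if does (u ≟ c) then t else u

replace-match : ∀ {n} (c t : Fin n) → replace c t c ≡ t
replace-match c t rewrite dec-true (c ≟ c) refl = refl

replace-other : ∀ {n} {c t u : Fin n} → u ≢ c → replace c t u ≡ u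
replace-other {c = c} {u = u} u≢c rewrite dec-false (u ≟ c) u≢c = refl

module ExprRing (V : Set) where

  ≈-isEquivalence : IsEquivalence (_≈_ {V})
  ≈-isEquivalence = record { refl = ≈-refl ; sym = ≈-sym ; trans = ≈-trans }

  isCommutativeRing : IsCommutativeRing (_≈_ {V}) _⊕_ _⊗_ ⊖_ (con 0ℚ) (con 1ℚ)
  isCommutativeRing = record
    { isRing = record
      { +-isAbelianGroup = record
        { isGroup = record
          { isMonoid = record
            { isSemigroup = record
              { isMagma = record { isEquivalence = ≈-isEquivalence ; ∙-cong = ⊕-cong }
              ; assoc = ⊕-assoc }
            ; identity = ⊕-idˡ , λ y → ≈-trans (⊕-comm _ _) (⊕-idˡ y) }
          ; inverse = (λ y → ≈-trans (⊕-comm _ _) (⊖-invʳ y)) , ⊖-invʳ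
          ; ⁻¹-cong = ⊖-cong }
        ; comm = ⊕-comm }
      ; *-cong = ⊗-cong
      ; *-assoc = ⊗-assoc
      ; *-identity = ⊗-idˡ , λ y → ≈-trans (⊗-comm _ _) (⊗-idˡ y)
      ; distrib = distribˡ , λ z x y → ≈-trans (⊗-comm _ _)
                    (≈-trans (distribˡ z x y) (⊕-cong (⊗-comm _ _) (⊗-comm _ _))) }
    ; *-comm = ⊗-comm }

  commutativeRing : CommutativeRing 0ℓ 0ℓ
  commutativeRing = record { isCommutativeRing = isCommutativeRing }

  open CommutativeRing commutativeRing public
    using (setoid; semiring; +-identityʳ; *-identityʳ; zeroʳ) renaming (reflexive to ≈-reflexive)
  open import Relation.Binary.Reasoning.Setoid setoid public
  open import Algebra.Properties.Ring (CommutativeRing.ring commutativeRing) public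
    using (-0#≈0#; -‿+-comm; -1*x≈-x)

  -- Coefficients are taken in ℚ (through con), where the solver's normal forms compute.
  module Solver where
    open import Algebra.Solver.Ring.AlmostCommutativeRing
      using (fromCommutativeRing; _-Raw-AlmostCommutative⟶_)

    con-neg : ∀ q → con (ℚ.- q) ≈ ⊖ con q
    con-neg q = begin
      con (ℚ.- q)                      ≈⟨ +-identityʳ _ ⟨
      con (ℚ.- q) ⊕ con 0ℚ             ≈⟨ ⊕-cong ≈-refl (⊖-invʳ (con q)) ⟨
      con (ℚ.- q) ⊕ (con q ⊕ ⊖ con q)  ≈⟨ ⊕-assoc _ _ _ ⟨
      (con (ℚ.- q) ⊕ con q) ⊕ ⊖ con q  ≈⟨ ⊕-cong (con-+ _ _) ≈-refl ⟨
      con (ℚ.- q ℚ.+ q) ⊕ ⊖ con q      ≡⟨ cong (λ r → con r ⊕ ⊖ con q) (ℚ.+-inverseˡ q) ⟩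
      con 0ℚ ⊕ ⊖ con q                 ≈⟨ ⊕-idˡ _ ⟩
      ⊖ con q                          ∎

    con-morphism : ℚ.+-*-rawRing -Raw-AlmostCommutative⟶ fromCommutativeRing commutativeRing
    con-morphism = record
      { ⟦_⟧ = con ; +-homo = con-+ ; *-homo = con-* ; -‿homo = con-neg
      ; 0-homo = ≈-refl ; 1-homo = ≈-refl }

    con-≟ : ∀ p q → Maybe (con {V} p ≈ con q)
    con-≟ p q with p ℚ.≟ q
    ... | yes refl = just ≈-refl
    ... | no _     = nothing

    open import Algebra.Solver.Ring ℚ.+-*-rawRing (fromCommutativeRing commutativeRing) con-morphism con-≟ public
      using (solve; _:+_; _:*_; :-_; _:-_; _:=_)

  open Solver public using (solve; _:+_; _:*_; :-_; _:-_; _:=_)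

  open import Algebra.Properties.Semiring.Sum semiring public
    using ( sum; sum-syntax; sum-cong-≗; sum-cong-≋; sum-replicate-zero; ∑-distrib-+; ∑-comm; sum-permute
          ; *-distribˡ-sum; *-distribʳ-sum)

  sumE-++ : (fs gs : List (Expr V)) → sumE (fs ++ gs) ≈ sumE fs ⊕ sumE gs
  sumE-++ []       gs = ≈-sym (⊕-idˡ _)
  sumE-++ (f ∷ fs) gs = ≈-trans (⊕-cong ≈-refl (sumE-++ fs gs)) (≈-sym (⊕-assoc _ _ _))

  sumE-concatMap : {A B : Set} (F : B → Expr V) (G : A → List B) (xs : List A) →
                   sumE (map F (concatMap G xs)) ≈ sumE (map (λ x → sumE (map F (G x))) xs)
  sumE-concatMap F G []       = ≈-refl
  sumE-concatMap F G (x ∷ xs) = begin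
    sumE (map F (G x ++ concatMap G xs))                 ≡⟨ cong sumE (List.map-++ F (G x) _) ⟩
    sumE (map F (G x) ++ map F (concatMap G xs))         ≈⟨ sumE-++ (map F (G x)) _ ⟩
    sumE (map F (G x)) ⊕ sumE (map F (concatMap G xs))   ≈⟨ ⊕-cong ≈-refl (sumE-concatMap F G xs) ⟩
    sumE (map F (G x)) ⊕ sumE (map (λ x → sumE (map F (G x))) xs) ∎

  sumE-tabulate : ∀ {m} (f : Fin m → Expr V) → sumE (tabulate f) ≡ sum f
  sumE-tabulate {zero}  f = refl
  sumE-tabulate {suc m} f = cong (f zero ⊕_) (sumE-tabulate (f ∘ suc))

  sumE-allFin : ∀ {m} (f : Fin m → Expr V) → sumE (map f (allFin m)) ≡ sum f
  sumE-allFin f = ≡.trans (cong sumE (List.map-tabulate id f)) (sumE-tabulate f)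

  ∑-neg : ∀ {m} (f : Fin m → Expr V) → ∑[ i < m ] ⊖ f i ≈ ⊖ sum f
  ∑-neg {zero}  f = ≈-sym -0#≈0#
  ∑-neg {suc m} f = ≈-trans (⊕-cong ≈-refl (∑-neg (f ∘ suc))) (-‿+-comm (f zero) _)

  ∑-zero : ∀ {m} {f : Fin m → Expr V} → (∀ i → f i ≈ con 0ℚ) → sum f ≈ con 0ℚ
  ∑-zero {m} f≈0 = ≈-trans (sum-cong-≋ f≈0) (sum-replicate-zero m)

  ∑-select : ∀ {m} {P : Fin m → Set} (P? : ∀ t → Dec (P t)) {j : Fin m} → P j → (∀ {t} → P t → t ≡ j) →
             (f : Fin m → Expr V) → ∑[ t < m ] (if does (P? t) then f t else con 0ℚ) ≈ f j
  ∑-select {suc m} P? {zero} Pj unique f with P? zero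
  ... | no ¬P0 = ⊥-elim (¬P0 Pj)
  ... | yes _  = ≈-trans (⊕-cong ≈-refl (∑-zero rest≈0)) (+-identityʳ _)
    where
      rest≈0 : ∀ t → (if does (P? (suc t)) then f (suc t) else con 0ℚ) ≈ con 0ℚ
      rest≈0 t with P? (suc t)
      ... | yes Pt = case unique Pt of λ ()
      ... | no _   = ≈-refl
  ∑-select {suc m} P? {suc j} Pj unique f with P? zero
  ... | yes P0 = case unique P0 of λ ()
  ... | no _   = ≈-trans (⊕-idˡ _) (∑-select (P? ∘ suc) Pj (suc-injective ∘ unique) (f ∘ suc))

  product : ∀ {m} → (Fin m → Expr V) → Expr V
  product f = prodE (tabulate f)

  product-one : ∀ {m} (f : Fin m → Expr V) → (∀ i → f i ≈ con 1ℚ) → product f ≈ con 1ℚ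
  product-one {zero}  f f≈1 = ≈-refl
  product-one {suc m} f f≈1 = ≈-trans (⊗-cong (f≈1 zero) (product-one (f ∘ suc) (f≈1 ∘ suc))) (⊗-idˡ _)

  product-cong : ∀ {m} {f g : Fin m → Expr V} → (∀ i → f i ≈ g i) → product f ≈ product g
  product-cong {zero}  f≈g = ≈-refl
  product-cong {suc m} f≈g = ⊗-cong (f≈g zero) (product-cong (f≈g ∘ suc))

  product-update : ∀ {m} (f g : Fin m → Expr V) c i → g i ≈ c ⊗ f i → (∀ j → j ≢ i → g j ≈ f j) →
                   product g ≈ c ⊗ product f
  product-update {suc m} f g c zero    gi g≈f =
    ≈-trans (⊗-cong gi (product-cong λ j → g≈f (suc j) λ ())) (⊗-assoc _ _ _)
  product-update {suc m} f g c (suc i) gi g≈f =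
    ≈-trans (⊗-cong (g≈f zero λ ())
                     (product-update (f ∘ suc) (g ∘ suc) c i gi λ j j≢i → g≈f (suc j) (j≢i ∘ suc-injective)))
            (solve 3 (λ a b c → a :* (c :* b) := c :* (a :* b)) ≈-refl (f zero) (product (f ∘ suc)) c)

  Combination : List (Expr V × Expr V) → Expr V
  Combination hgs = sumE (map (λ hg → proj₁ hg ⊗ proj₂ hg) hgs)

  -- Shaped so that InIdeal n a is Ideal (Gen n a) definitionally.
  Ideal : (Expr V → Set) → Expr V → Set
  Ideal G f = Σ (List (Expr V × Expr V)) λ hgs → All (λ hg → G (proj₂ hg)) hgs × (f ≈ Combination hgs)

  combination-++ : ∀ hgs hgs′ → Combination (hgs ++ hgs′) ≈ Combination hgs ⊕ Combination hgs′
  combination-++ hgs hgs′ = ≈-trans (≈-reflexive (cong sumE (List.map-++ _ hgs hgs′))) (sumE-++ (map _ hgs) _)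

  scale : Expr V → Expr V × Expr V → Expr V × Expr V
  scale h (h′ , g) = (h ⊗ h′ , g)

  combination-scale : ∀ h hgs → h ⊗ Combination hgs ≈ Combination (map (scale h) hgs)
  combination-scale h []         = zeroʳ h
  combination-scale h (hg ∷ hgs) =
    ≈-trans (distribˡ _ _ _) (⊕-cong (≈-sym (⊗-assoc _ _ _)) (combination-scale h hgs))

  module _ {G : Expr V → Set} where

    ideal-gen : ∀ {g} → G g → Ideal G g
    ideal-gen {g} Gg = (con 1ℚ , g) ∷ [] , Gg ∷ [] , ≈-sym (≈-trans (+-identityʳ _) (⊗-idˡ g))

    ideal-0 : Ideal G (con 0ℚ)
    ideal-0 = [] , [] , ≈-refl

    ideal-+ : ∀ {f f′} → Ideal G f → Ideal G f′ → Ideal G (f ⊕ f′)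
    ideal-+ (hgs , Gs , f≈) (hgs′ , Gs′ , f′≈) =
      hgs ++ hgs′ , ++⁺ Gs Gs′ , ≈-trans (⊕-cong f≈ f′≈) (≈-sym (combination-++ hgs hgs′))

    ideal-* : ∀ h {f} → Ideal G f → Ideal G (h ⊗ f)
    ideal-* h (hgs , Gs , f≈) =
      map (scale h) hgs , map⁺ (All-map id Gs) , ≈-trans (⊗-cong ≈-refl f≈) (combination-scale h hgs)

    ideal-resp : ∀ {f f′} → f ≈ f′ → Ideal G f → Ideal G f′
    ideal-resp f≈f′ (hgs , Gs , f≈) = hgs , Gs , ≈-trans (≈-sym f≈f′) f≈

    ideal-*ʳ : ∀ {f} h → Ideal G f → Ideal G (f ⊗ h)
    ideal-*ʳ h I = ideal-resp (⊗-comm h _) (ideal-* h I)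

    ideal-neg : ∀ {f} → Ideal G f → Ideal G (⊖ f)
    ideal-neg I = ideal-resp (-1*x≈-x _) (ideal-* (⊖ con 1ℚ) I)

    ideal-∑ : ∀ {m} {f : Fin m → Expr V} → (∀ i → Ideal G (f i)) → Ideal G (sum f)
    ideal-∑ {zero}  I = ideal-0
    ideal-∑ {suc m} I = ideal-+ (I zero) (ideal-∑ (I ∘ suc))

    ideal-rename : (ρ : V → V) → (∀ {g} → G g → Ideal G (rename ρ g)) → ∀ {f} → Ideal G f → Ideal G (rename ρ f)
    ideal-rename ρ G-stable (hgs , Gs , f≈) = ideal-resp (≈-sym (rename-cong ρ f≈)) (combination∈ hgs Gs)
      where
        combination∈ : ∀ hgs → All (λ hg → G (proj₂ hg)) hgs → Ideal G (rename ρ (Combination hgs))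
        combination∈ []              []        = ideal-0
        combination∈ ((h , g) ∷ hgs) (Gg ∷ Gs) = ideal-+ (ideal-* (rename ρ h) (G-stable Gg)) (combination∈ hgs Gs)

  ideal-bind : ∀ {G H : Expr V → Set} {f} → (∀ {g} → G g → Ideal H g) → Ideal G f → Ideal H f
  ideal-bind {G} {H} G⊆H (hgs , Gs , f≈) = ideal-resp (≈-sym f≈) (combination∈ hgs Gs)
    where
      combination∈ : ∀ hgs → All (λ hg → G (proj₂ hg)) hgs → Ideal H (Combination hgs)
      combination∈ []              []        = ideal-0
      combination∈ ((h , g) ∷ hgs) (Gg ∷ Gs) = ideal-+ (ideal-* h (G⊆H Gg)) (combination∈ hgs Gs)

  data Span (P : Expr V → Set) : Expr V → Set where
    gen       : ∀ {f} → P f → Span P f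
    span-0    : Span P (con 0ℚ)
    span-+    : ∀ {f g} → Span P f → Span P g → Span P (f ⊕ g)
    span-neg  : ∀ {f} → Span P f → Span P (⊖ f)
    span-resp : ∀ {f g} → f ≈ g → Span P f → Span P g

  span-∑ : ∀ {P m} {f : Fin m → Expr V} → (∀ i → Span P (f i)) → Span P (sum f)
  span-∑ {m = zero}  S = span-0
  span-∑ {m = suc m} S = span-+ (S zero) (span-∑ (S ∘ suc))

  rename-∑ : (ρ : V → V) {m : ℕ} (f : Fin m → Expr V) → rename ρ (sum f) ≡ sum (rename ρ ∘ f)
  rename-∑ ρ {zero}  f = refl
  rename-∑ ρ {suc m} f = cong (rename ρ (f zero) ⊕_) (rename-∑ ρ (f ∘ suc))

  module _ {p m} {ι : Fin p → Fin m} (ι-inj : Injective _≡_ _≡_ ι) where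

    onlyOutside : (Fin m → Expr V) → Fin m → Expr V
    onlyOutside F t with image? ι t
    ... | yes _ = con 0ℚ
    ... | no _  = F t

    split-at : (F : Fin m → Expr V) (t : Fin m) →
               F t ≈ ∑[ k < p ] (if does (ι k ≟ t) then F t else con 0ℚ) ⊕ onlyOutside F t
    split-at F t with image? ι t
    ... | yes (k₀ , refl) =
      ≈-sym (≈-trans (⊕-cong (∑-select (λ k → ι k ≟ ι k₀) refl ι-inj (λ _ → F (ι k₀))) ≈-refl) (+-identityʳ _))
    ... | no t∉ι = ≈-sym (≈-trans (⊕-cong (∑-zero not-ι) ≈-refl) (⊕-idˡ _))
      where
        not-ι : ∀ k → (if does (ι k ≟ t) then F t else con 0ℚ) ≈ con 0ℚ
        not-ι k with ι k ≟ t
        ... | yes ιk≡t = ⊥-elim (t∉ι (k , ιk≡t))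
        ... | no _     = ≈-refl

    window-split : (F : Fin m → Expr V) → sum F ≈ ∑[ k < p ] F (ι k) ⊕ sum (onlyOutside F)
    window-split F = begin
      sum F                                        ≈⟨ sum-cong-≋ (split-at F) ⟩
      ∑[ t < m ] (∑[ k < p ] δ k t ⊕ rest t)       ≈⟨ ∑-distrib-+ (λ t → ∑[ k < p ] δ k t) rest ⟩
      ∑[ t < m ] ∑[ k < p ] δ k t ⊕ sum rest       ≈⟨ ⊕-cong (∑-comm (λ t k → δ k t)) ≈-refl ⟩
      ∑[ k < p ] ∑[ t < m ] δ k t ⊕ sum rest       ≈⟨ ⊕-cong (sum-cong-≋ λ k → ∑-select (ι k ≟_) refl ≡.sym F) ≈-refl ⟩
      ∑[ k < p ] F (ι k) ⊕ sum rest                ∎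
      where
        δ : Fin p → Fin m → Expr V
        δ k t = if does (ι k ≟ t) then F t else con 0ℚ
        rest : Fin m → Expr V
        rest = onlyOutside F

module Matrix (n : ℕ) where

  open ExprRing (Var n)

  both : (Fin n → Fin n) → Var n → Var n
  both ρ ij = ρ (proj₁ ij) , ρ (proj₂ ij)

  Both : (Fin n → Set) → Var n → Set
  Both P ij = P (proj₁ ij) × P (proj₂ ij)

  monomial : List (Var n) → Expr (Var n)
  monomial L = prodE (map var L)

  act-monomial : ∀ ρ L → act ρ (monomial L) ≡ monomial (map (both ρ) L)
  act-monomial ρ []      = refl
  act-monomial ρ (e ∷ L) = cong (var (both ρ e) ⊗_) (act-monomial ρ L)

  act-monomial-local : ∀ {P : Fin n → Set} {ρ ρ′} → (∀ {u} → P u → ρ u ≡ ρ′ u) →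
                       ∀ {L} → All (Both P) L → act ρ (monomial L) ≡ act ρ′ (monomial L)
  act-monomial-local ρ≡ρ′ []                = refl
  act-monomial-local ρ≡ρ′ ((Pu , Pv) ∷ PL) =
    cong₂ _⊗_ (cong₂ x (ρ≡ρ′ Pu) (ρ≡ρ′ Pv)) (act-monomial-local ρ≡ρ′ PL)

  act-fixes-monomial : ∀ {P : Fin n → Set} {ρ} → (∀ {u} → P u → ρ u ≡ u) →
                       ∀ {L} → All (Both P) L → act ρ (monomial L) ≡ monomial L
  act-fixes-monomial ρ≡id PL = ≡.trans (act-monomial-local ρ≡id PL) (rename-id (λ _ → refl) _)

  data Gen₀ : Expr (Var n) → Set where
    rowSum  : ∀ i → Gen₀ (∑[ j < n ] x i j)
    colSum  : ∀ j → Gen₀ (∑[ i < n ] x i j)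
    rowProd : ∀ i j j′ → Gen₀ (x i j ⊗ x i j′)
    colProd : ∀ i i′ j → Gen₀ (x i j ⊗ x i′ j)
    symDiff : ∀ i j → Gen₀ (x i j ⊕ (⊖ x j i))
    diagSum : Gen₀ (∑[ i < n ] x i i)

  I₀ : Expr (Var n) → Set
  I₀ = Ideal Gen₀

  I₀⊆InIdeal : ∀ {a f} → I₀ f → InIdeal n a f
  I₀⊆InIdeal {a} = ideal-bind gen₀∈
    where
      gen₀∈ : ∀ {g} → Gen₀ g → InIdeal n a g
      gen₀∈ (rowSum i)        = ≡.subst (InIdeal n a) (sumE-allFin (x i)) (ideal-gen (Gen.rowSum i))
      gen₀∈ (colSum j)        = ≡.subst (InIdeal n a) (sumE-allFin (λ i → x i j)) (ideal-gen (Gen.colSum j))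
      gen₀∈ (rowProd i j j′)  = ideal-gen (Gen.rowProd i j j′)
      gen₀∈ (colProd i i′ j)  = ideal-gen (Gen.colProd i i′ j)
      gen₀∈ (symDiff i j)     = ideal-gen (Gen.symDiff i j)
      gen₀∈ diagSum           = ≡.subst (InIdeal n a) (sumE-allFin (λ i → x i i)) (ideal-gen Gen.diagSum)

  I₀-permute : (π : Permutation n n) → ∀ {f} → I₀ f → I₀ (act (π ⟨$⟩ʳ_) f)
  I₀-permute π = ideal-rename (both (π ⟨$⟩ʳ_)) permuted
    where
      ρ : Fin n → Fin n
      ρ = π ⟨$⟩ʳ_
      reindex : ∀ {f : Fin n → Expr (Var n)} {g} → Gen₀ (sum f) → sum (f ∘ ρ) ≡ g → I₀ g
      reindex G refl = ideal-resp (sum-permute _ π) (ideal-gen G)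
      permuted : ∀ {g} → Gen₀ g → I₀ (act ρ g)
      permuted (rowSum i)       = reindex (rowSum (ρ i)) (≡.sym (rename-∑ (both ρ) (x i)))
      permuted (colSum j)       = reindex (colSum (ρ j)) (≡.sym (rename-∑ (both ρ) (λ i → x i j)))
      permuted (rowProd i j j′) = ideal-gen (rowProd _ _ _)
      permuted (colProd i i′ j) = ideal-gen (colProd _ _ _)
      permuted (symDiff i j)    = ideal-gen (symDiff _ _)
      permuted diagSum          = reindex diagSum (≡.sym (rename-∑ (both ρ) (λ i → x i i)))

  Touches : Fin n → Var n → Set
  Touches c e = proj₁ e ≡ c ⊎ proj₂ e ≡ c

  touches? : ∀ c e → Dec (Touches c e)
  touches? c e = (proj₁ e ≟ c) ⊎-dec (proj₂ e ≟ c)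

  untouched : ∀ {c e} → ¬ Touches c e → Both (_≢ c) e
  untouched ¬t = (λ e → ¬t (inj₁ e)) , (λ e → ¬t (inj₂ e))

  Shares : Var n → Var n → Set
  Shares e e′ = Touches (proj₁ e) e′ ⊎ Touches (proj₂ e) e′

  touching-shares : ∀ {t e e′} → Touches t e → Touches t e′ → Shares e e′
  touching-shares (inj₁ refl) t′ = inj₁ t′
  touching-shares (inj₂ refl) t′ = inj₂ t′

  -- Symmetry moves the shared index into the same row or column.
  sharing-pair : ∀ e e′ → Shares e e′ → I₀ (var e ⊗ var e′)
  sharing-pair (i , j) (.i , v) (inj₁ (inj₁ refl)) = ideal-gen (rowProd i j v)
  sharing-pair (i , j) (u , .i) (inj₁ (inj₂ refl)) =
    ideal-resp (solve 3 (λ a b c → a :* b :+ a :* (c :- b) := a :* c) ≈-refl (x i j) (x i u) (x u i))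
               (ideal-+ (ideal-gen (rowProd i j u)) (ideal-* (x i j) (ideal-gen (symDiff u i))))
  sharing-pair (i , j) (.j , v) (inj₂ (inj₁ refl)) =
    ideal-resp (solve 3 (λ a b c → b :* c :+ (a :- b) :* c := a :* c) ≈-refl (x i j) (x j i) (x j v))
               (ideal-+ (ideal-gen (rowProd j i v)) (ideal-*ʳ (x j v) (ideal-gen (symDiff i j))))
  sharing-pair (i , j) (u , .j) (inj₂ (inj₂ refl)) = ideal-gen (colProd i u j)

  sharing-monomial : ∀ e {L} → Any (Shares e) L → I₀ (var e ⊗ monomial L)
  sharing-monomial e {e′ ∷ L} (here sh) = ideal-resp (⊗-assoc _ _ _) (ideal-*ʳ (monomial L) (sharing-pair e e′ sh))
  sharing-monomial e {e′ ∷ L} (there sh) =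
    ideal-resp (solve 3 (λ a b c → b :* (a :* c) := a :* (b :* c)) ≈-refl (var e) (var e′) (monomial L))
               (ideal-* (var e′) (sharing-monomial e sh))

  replace-touches : ∀ {c e} t → Touches c e → Touches t (both (replace c t) e)
  replace-touches {c} t (inj₁ refl) = inj₁ (replace-match c t)
  replace-touches {c} t (inj₂ refl) = inj₂ (replace-match c t)

  ∑-replace-var : ∀ c e → Touches c e → I₀ (∑[ t < n ] var (both (replace c t) e))
  ∑-replace-var c (u , v) touch with u ≟ c | v ≟ c
  ... | yes refl | yes refl = ideal-gen diagSum
  ... | yes refl | no _     = ideal-gen (colSum v)
  ... | no _     | yes refl = ideal-gen (rowSum u)
  ... | no u≢c   | no v≢c   = ⊥-elim ([ u≢c , v≢c ]′ touch)

  ∑-replace : ∀ c L → Any (Touches c) L → I₀ (∑[ t < n ] act (replace c t) (monomial L))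
  ∑-replace c (e ∷ L) touchL with touches? c e
  ... | no ¬touch = ideal-resp pull-out (ideal-* (var e) (∑-replace c L (Any.tail ¬touch touchL)))
    where
      e-fixed : ∀ t → both (replace c t) e ≡ e
      e-fixed t = cong₂ _,_ (replace-other (proj₁ (untouched ¬touch))) (replace-other (proj₂ (untouched ¬touch)))
      pull-out : var e ⊗ ∑[ t < n ] act (replace c t) (monomial L) ≈
                 ∑[ t < n ] act (replace c t) (monomial (e ∷ L))
      pull-out = ≈-trans (*-distribˡ-sum (var e) (λ t → act (replace c t) (monomial L)))
                         (≈-reflexive (sum-cong-≗ λ t → cong (λ e′ → var e′ ⊗ _) (≡.sym (e-fixed t))))
  ... | yes touch with Any.any? (touches? c) L
  ...   | yes touchL′ = ideal-∑ λ t →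
            ≡.subst I₀ (≡.sym (act-monomial (replace c t) (e ∷ L)))
              (sharing-monomial _ (Any.map (touching-shares (replace-touches t touch))
                                           (Any-map⁺ (Any.map (replace-touches t) touchL′))))
  ...   | no ¬touchL′ = ideal-resp factor (ideal-*ʳ (monomial L) (∑-replace-var c e touch))
    where
      L-fixed : ∀ t → act (replace c t) (monomial L) ≡ monomial L
      L-fixed t = act-fixes-monomial replace-other (All-map untouched (¬Any⇒All¬ L ¬touchL′))
      factor : (∑[ t < n ] var (both (replace c t) e)) ⊗ monomial L ≈
               ∑[ t < n ] act (replace c t) (monomial (e ∷ L))
      factor = ≈-trans (*-distribʳ-sum (monomial L) (λ t → var (both (replace c t) e)))
                       (≈-reflexive (sum-cong-≗ λ t → cong (_ ⊗_) (≡.sym (L-fixed t))))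

  symmetrize : ∀ {p} → (Fin p → Fin n) → Expr (Var n) → Expr (Var n)
  symmetrize {p} ι f = sumE (map (λ σ → act (extend ι σ) f) (perms p))

  η·≡symmetrize : ∀ {p} (p≤n : p ≤ n) f → η· p p≤n f ≡ symmetrize (λ k → inject≤ k p≤n) f
  η·≡symmetrize {p} p≤n f = cong sumE (List.map-cong embedded (perms p))
    where
      embedded : ∀ σ → act (embed p≤n σ) f ≡ act (extend (λ k → inject≤ k p≤n) σ) f
      embedded σ = rename-≗ (λ _ → cong₂ _,_ (embed≗extend p≤n σ _) (embed≗extend p≤n σ _)) f

  symmetrize-zero : (ι : Fin 0 → Fin n) (f : Expr (Var n)) → symmetrize ι f ≈ f
  symmetrize-zero ι f =
    ≈-trans (+-identityʳ _) (≈-reflexive (rename-id (λ _ → cong₂ _,_ (extend-outside id ∉ι) (extend-outside id ∉ι)) f))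
    where
      ∉ι : ∀ {i} → ¬ Image ι i
      ∉ι (() , _)

  symmetrize-suc : ∀ {p} {ι : Fin (suc p) → Fin n} → Injective _≡_ _≡_ ι → ∀ f →
                   symmetrize ι f ≈ ∑[ k < suc p ] act (transpose (ι zero) (ι k)) (symmetrize (ι ∘ suc) f)
  symmetrize-suc {p} {ι} ι-inj f = begin
    sumE (map F (concatMap G (allFin (suc p))))                   ≈⟨ sumE-concatMap F G (allFin (suc p)) ⟩
    sumE (map (λ k → sumE (map F (G k))) (allFin (suc p)))        ≡⟨ sumE-allFin (λ k → sumE (map F (G k))) ⟩
    ∑[ k < suc p ] sumE (map F (G k))                             ≈⟨ sum-cong-≋ orbit ⟩
    ∑[ k < suc p ] act (τ k) (symmetrize (ι ∘ suc) f)             ∎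
    where
      F : (Fin (suc p) → Fin (suc p)) → Expr (Var n)
      F σ = act (extend ι σ) f
      G : Fin (suc p) → List (Fin (suc p) → Fin (suc p))
      G k = map (λ σ → swap0 k ∘ ext0 σ) (perms p)
      F′ : (Fin p → Fin p) → Expr (Var n)
      F′ σ = act (extend (ι ∘ suc) σ) f
      τ : Fin (suc p) → Fin n → Fin n
      τ k = transpose (ι zero) (ι k)
      orbit : ∀ k → sumE (map F (G k)) ≈ act (τ k) (symmetrize (ι ∘ suc) f)
      orbit k = begin
        sumE (map F (G k))                                                 ≡⟨ cong sumE (List.map-∘ (perms p)) ⟨
        sumE (map (λ σ → act (extend ι (swap0 k ∘ ext0 σ)) f) (perms p))   ≡⟨ cong sumE (List.map-cong factor (perms p)) ⟩
        sumE (map (λ σ → act (τ k) (F′ σ)) (perms p))                       ≡⟨ cong sumE (List.map-∘ (perms p)) ⟩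
        sumE (map (act (τ k)) (map F′ (perms p)))                          ≡⟨ rename-sumE (both (τ k)) (map F′ (perms p)) ⟨
        act (τ k) (symmetrize (ι ∘ suc) f)                                 ∎
        where
          factor : ∀ σ → act (extend ι (swap0 k ∘ ext0 σ)) f ≡ act (τ k) (F′ σ)
          factor σ = ≡.trans (rename-≗ (λ _ → cong₂ _,_ (extend-swap0-ext0 ι-inj k σ _) (extend-swap0-ext0 ι-inj k σ _)) f)
                             (≡.sym (rename-∘ _ _ f))

  Outside : ∀ {p} → (Fin p → Fin n) → Fin n → Set
  Outside ι u = ¬ Image ι u

  data OutsideMonomial {p} (ι : Fin p → Fin n) (D : ℕ) : Expr (Var n) → Set where
    outside-monomial : ∀ {L} → length L ≡ D → All (Both (Outside ι)) L → OutsideMonomial ι D (monomial L)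

  Reduced : ∀ {p} → (Fin p → Fin n) → ℕ → Expr (Var n) → Set
  Reduced ι D = Span (λ f → I₀ f ⊎ OutsideMonomial ι D f)

  module Step {p} {ι : Fin (suc p) → Fin n} (ι-inj : Injective _≡_ _≡_ ι) where

    c : Fin n
    c = ι zero

    τ : Fin (suc p) → Fin n → Fin n
    τ k = transpose c (ι k)

    outside-tail : ∀ {u} → Outside (ι ∘ suc) u → u ≢ c → Outside ι u
    outside-tail u∉ u≢c (zero  , c≡u) = u≢c (≡.sym c≡u)
    outside-tail u∉ u≢c (suc k , e)   = u∉ (k , e)

    τ-fixes : ∀ k {u} → Outside ι u → τ k u ≡ u
    τ-fixes k u∉ = transpose-other (λ u≡c → u∉ (zero , ≡.sym u≡c)) (λ u≡ιk → u∉ (k , ≡.sym u≡ιk))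

    τ≗replace : ∀ k {u} → Outside (ι ∘ suc) u → τ k u ≡ replace c (ι k) u
    τ≗replace k {u} u∉ = by-cases (u ≟ c)
      where
        by-cases : Dec (u ≡ c) → τ k u ≡ replace c (ι k) u
        by-cases (yes refl) = ≡.trans (transpose-matchˡ c (ι k)) (≡.sym (replace-match c (ι k)))
        by-cases (no u≢c)   = ≡.trans (τ-fixes k (outside-tail u∉ u≢c)) (≡.sym (replace-other u≢c))

    replace-outside : ∀ {t u} → Outside ι t → Outside (ι ∘ suc) u → Outside ι (replace c t u)
    replace-outside {t} {u} t∉ u∉ with u ≟ c
    ... | yes _  = t∉
    ... | no u≢c = outside-tail u∉ u≢c

    step-monomial : ∀ {D L} → length L ≡ D → All (Both (Outside (ι ∘ suc))) L →
                    Reduced ι D (∑[ k < suc p ] act (τ k) (monomial L))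
    step-monomial {D} {L} len L∉ with Any.any? (touches? c) L
    ... | no ¬touch = span-∑ λ k → ≡.subst (Reduced ι D) (≡.sym (act-fixes-monomial (τ-fixes k) L∉ι))
                                     (gen (inj₂ (outside-monomial len L∉ι)))
      where
        L∉ι : All (Both (Outside ι)) L
        L∉ι = All-zipWith (λ ((u∉ , v∉) , (u≢c , v≢c)) → outside-tail u∉ u≢c , outside-tail v∉ v≢c)
                          (L∉ , All-map untouched (¬Any⇒All¬ L ¬touch))
    ... | yes touch = span-resp rearrange (span-+ (gen (inj₁ (∑-replace c L touch))) (span-neg (span-∑ outside-part)))
      where
        F : Fin n → Expr (Var n)
        F t = act (replace c t) (monomial L)
        outside-part : ∀ t → Reduced ι D (onlyOutside ι-inj F t)
        outside-part t with image? ι t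
        ... | yes _  = span-0
        ... | no t∉ = ≡.subst (Reduced ι D) (≡.sym (act-monomial (replace c t) L))
                        (gen (inj₂ (outside-monomial (≡.trans (List.length-map _ L) len)
                          (map⁺ (All-map (λ (u∉ , v∉) → replace-outside t∉ u∉ , replace-outside t∉ v∉) L∉)))))
        rearrange : sum F ⊕ ⊖ sum (onlyOutside ι-inj F) ≈ ∑[ k < suc p ] act (τ k) (monomial L)
        rearrange = begin
          sum F ⊕ ⊖ sum rest                                  ≈⟨ ⊕-cong (window-split ι-inj F) ≈-refl ⟩
          (∑[ k < suc p ] F (ι k) ⊕ sum rest) ⊕ ⊖ sum rest    ≈⟨ solve 2 (λ A B → (A :+ B) :- B := A) ≈-refl _ _ ⟩
          ∑[ k < suc p ] F (ι k)                              ≡⟨ sum-cong-≗ (λ k → act-monomial-local (τ≗replace k) L∉) ⟨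
          ∑[ k < suc p ] act (τ k) (monomial L)               ∎
          where
            rest : Fin n → Expr (Var n)
            rest = onlyOutside ι-inj F

    step : ∀ {D f} → Reduced (ι ∘ suc) D f → Reduced ι D (∑[ k < suc p ] act (τ k) f)
    step (gen (inj₁ I))                          = gen (inj₁ (ideal-∑ λ k → I₀-permute (Perm.transpose c (ι k)) I))
    step (gen (inj₂ (outside-monomial len L∉))) = step-monomial len L∉
    step span-0                                  = span-resp (≈-sym (∑-zero {suc p} {λ _ → con 0ℚ} λ _ → ≈-refl)) span-0
    step (span-+ {f} {g} S S′)                   = span-resp (≈-sym (∑-distrib-+ (λ k → act (τ k) f) (λ k → act (τ k) g)))
                                                             (span-+ (step S) (step S′))
    step (span-neg {f} S)                        = span-resp (≈-sym (∑-neg (λ k → act (τ k) f))) (span-neg (step S))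
    step (span-resp f≈g S)                       = span-resp (sum-cong-≋ λ k → rename-cong (both (τ k)) f≈g) (step S)

  reduce : ∀ {p} {ι : Fin p → Fin n} → Injective _≡_ _≡_ ι → ∀ L → Reduced ι (length L) (symmetrize ι (monomial L))
  reduce {zero}  {ι} ι-inj L = span-resp (≈-sym (symmetrize-zero ι _))
                                 (gen (inj₂ (outside-monomial refl (universal (λ _ → ∉ι , ∉ι) L))))
    where
      ∉ι : ∀ {i} → Outside ι i
      ∉ι (() , _)
  reduce {suc p} ι-inj L = span-resp (≈-sym (symmetrize-suc ι-inj _)) (Step.step ι-inj (reduce (suc-injective ∘ ι-inj) L))

  diagFactor : Subset n → Fin n → Expr (Var n)
  diagFactor S i = if lookup S i then x i i else con 1ℚ

  diagProd≡product : ∀ S → diagProd S ≡ product (diagFactor S)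
  diagProd≡product S = cong prodE (List.map-tabulate id (diagFactor S))

  diagProd-insert : ∀ S i → lookup S i ≡ outside → diagProd (S [ i ]≔ inside) ≈ x i i ⊗ diagProd S
  diagProd-insert S i Si = begin
    diagProd (S [ i ]≔ inside)               ≡⟨ diagProd≡product (S [ i ]≔ inside) ⟩
    product (diagFactor (S [ i ]≔ inside))   ≈⟨ product-update _ _ (x i i) i at-i elsewhere ⟩
    x i i ⊗ product (diagFactor S)           ≡⟨ cong (x i i ⊗_) (diagProd≡product S) ⟨
    x i i ⊗ diagProd S                       ∎
    where
      at-i : diagFactor (S [ i ]≔ inside) i ≈ x i i ⊗ diagFactor S i
      at-i rewrite lookup∘update i S inside | Si = ≈-sym (*-identityʳ _)
      elsewhere : ∀ j → j ≢ i → diagFactor (S [ i ]≔ inside) j ≈ diagFactor S j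
      elsewhere j j≢i rewrite lookup∘update′ j≢i S inside = ≈-refl

  diagProd-⊥ : diagProd ⊥ ≈ con 1ℚ
  diagProd-⊥ = ≈-trans (≈-reflexive (diagProd≡product ⊥))
                       (product-one _ λ i → ≈-reflexive (cong (λ b → if b then x i i else con 1ℚ) (lookup-replicate i outside)))

  Member : Subset n → Fin n → Set
  Member F u = lookup F u ≡ inside

  Disjoint : Subset n → Subset n → Set
  Disjoint F S = ∀ u → Member F u → lookup S u ≡ outside

  member-removed : ∀ {F i u} → Member (F [ i ]≔ outside) u → u ≢ i × Member F u
  member-removed {F} {i} {u} Fu with u ≟ i
  ... | yes refl = case ≡.trans (≡.sym (lookup∘update u F outside)) Fu of λ ()
  ... | no u≢i   = u≢i , ≡.trans (≡.sym (lookup∘update′ u≢i F outside)) Fu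

  remove-index : ∀ {F i L} → All (Both (Member F)) L → All (¬_ ∘ Touches i) L →
                 All (Both (Member (F [ i ]≔ outside))) L
  remove-index {F} FL avoid = All-zipWith (λ ((Fu , Fv) , ¬touch) →
      ≡.trans (lookup∘update′ (proj₁ (untouched ¬touch)) F outside) Fu ,
      ≡.trans (lookup∘update′ (proj₂ (untouched ¬touch)) F outside) Fv)
    (FL , avoid)

  disjoint-remove : ∀ {F S i} → Disjoint F S → Disjoint (F [ i ]≔ outside) S
  disjoint-remove {F} {i = i} disj u Fu = disj u (proj₂ (member-removed {F} {i} Fu))

  disjoint-insert : ∀ {F S i} → Disjoint F S → Disjoint (F [ i ]≔ outside) (S [ i ]≔ inside)
  disjoint-insert {F} {S} {i} disj u Fu =
    ≡.trans (lookup∘update′ (proj₁ (member-removed {F} {i} Fu)) S inside) (disj u (proj₂ (member-removed {F} {i} Fu)))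

  shares? : ∀ e e′ → Dec (Shares e e′)
  shares? e e′ = touches? (proj₁ e) e′ ⊎-dec touches? (proj₂ e) e′

  ¬shares⇒avoids : ∀ {e L} → ¬ Any (Shares e) L → All (¬_ ∘ Touches (proj₁ e)) L × All (¬_ ∘ Touches (proj₂ e)) L
  ¬shares⇒avoids {e} {L} ¬share = All-map (λ ¬s t → ¬s (inj₁ t)) avoid , All-map (λ ¬s t → ¬s (inj₂ t)) avoid
    where
      avoid : All (¬_ ∘ Shares e) L
      avoid = ¬Any⇒All¬ L ¬share

  module _ (a : ℕ) where

    count-diagonal : ∀ {f f′ s s′} l → suc f′ ≡ f → s′ ≡ suc s → f + a < 2 * suc l + s → f′ + a < 2 * l + s′
    count-diagonal {f′ = f′} {s} l refl refl count =
      ≡.subst (f′ + a <_) (≡.sym (ℕ.+-suc (2 * l) s))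
        (ℕ.≤-pred (≡.subst (suc f′ + a <_) (cong (_+ s) (ℕ.*-suc 2 l)) count))

    count-offdiagonal : ∀ {f f″ s} l → suc (suc f″) ≡ f → f + a < 2 * suc l + s → f″ + a < 2 * l + s
    count-offdiagonal {f″ = f″} {s} l refl count =
      ℕ.≤-pred (ℕ.≤-pred (≡.subst (suc (suc f″) + a <_) (cong (_+ s) (ℕ.*-suc 2 l)) count))

    -- F holds the indices still available, S the diagonal factors already set aside:
    -- a diagonal factor moves one index from F to S, an off-diagonal one uses up two.
    diagonal-count : ∀ L (F S : Subset n) → All (Both (Member F)) L → Disjoint F S →
                     ∣ F ∣ + a < 2 * length L + ∣ S ∣ → InIdeal n a (diagProd S ⊗ monomial L)
    diagonal-count [] F S _ _ count =
      ideal-resp (≈-sym (*-identityʳ _)) (ideal-gen (diagBig S (ℕ.≤-trans (ℕ.s≤s (ℕ.m≤n+m a ∣ F ∣)) count)))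
    diagonal-count ((i , j) ∷ L) F S ((Fi , Fj) ∷ FL) disj count with Any.any? (shares? (i , j)) L
    ... | yes share = ideal-* (diagProd S) (I₀⊆InIdeal (sharing-monomial (i , j) share))
    ... | no ¬share with i ≟ j
    ...   | yes refl = ideal-resp regroup (diagonal-count L F′ S′ F′L (disjoint-insert {F} {S} {i} disj) count′)
      where
        F′ S′ : Subset n
        F′ = F [ i ]≔ outside
        S′ = S [ i ]≔ inside
        F′L : All (Both (Member F′)) L
        F′L = remove-index {F} {i} FL (proj₁ (¬shares⇒avoids ¬share))
        count′ : ∣ F′ ∣ + a < 2 * length L + ∣ S′ ∣
        count′ = count-diagonal (length L) (∣p[i]≔outside∣ F i Fi) (∣p[i]≔inside∣ S i (disj i Fi)) count
        regroup : diagProd S′ ⊗ monomial L ≈ diagProd S ⊗ (x i i ⊗ monomial L)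
        regroup = ≈-trans (⊗-cong (diagProd-insert S i (disj i Fi)) ≈-refl)
                          (solve 3 (λ a b c → (a :* b) :* c := b :* (a :* c)) ≈-refl (x i i) (diagProd S) (monomial L))
    ...   | no i≢j = ideal-resp regroup (ideal-* (x i j) (diagonal-count L F″ S F″L disj″ count″))
      where
        F′ F″ : Subset n
        F′ = F [ i ]≔ outside
        F″ = F′ [ j ]≔ outside
        Fj′ : Member F′ j
        Fj′ = ≡.trans (lookup∘update′ (i≢j ∘ ≡.sym) F outside) Fj
        F″L : All (Both (Member F″)) L
        F″L = remove-index {F′} {j} (remove-index {F} {i} FL (proj₁ (¬shares⇒avoids ¬share))) (proj₂ (¬shares⇒avoids ¬share))
        disj″ : Disjoint F″ S
        disj″ = disjoint-remove {F′} {S} {j} (disjoint-remove {F} {S} {i} disj)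
        count″ : ∣ F″ ∣ + a < 2 * length L + ∣ S ∣
        count″ = count-offdiagonal (length L) (≡.trans (cong suc (∣p[i]≔outside∣ F′ j Fj′)) (∣p[i]≔outside∣ F i Fi)) count
        regroup : x i j ⊗ (diagProd S ⊗ monomial L) ≈ diagProd S ⊗ (x i j ⊗ monomial L)
        regroup = solve 3 (λ a b c → a :* (b :* c) := b :* (a :* c)) ≈-refl (x i j) (diagProd S) (monomial L)

    outside-in-ideal : ∀ {p} (p≤n : p ≤ n) L → (n ∸ p) + a < 2 * length L →
                       All (Both (Outside (λ k → inject≤ k p≤n))) L → InIdeal n a (monomial L)
    outside-in-ideal {p} p≤n L count L∉ =
      ideal-resp (≈-trans (⊗-cong diagProd-⊥ ≈-refl) (⊗-idˡ _))
        (diagonal-count L F₀ ⊥ (All-map (λ (u∉ , v∉) → ∈F₀ u∉ , ∈F₀ v∉) L∉)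
           (λ u _ → lookup-replicate u outside) count₀)
      where
        F₀ : Subset n
        F₀ = Vec.tabulate (λ i → does (p ℕ.≤? toℕ i))
        ∈F₀ : ∀ {u} → Outside (λ k → inject≤ k p≤n) u → Member F₀ u
        ∈F₀ {u} u∉ = ≡.trans (lookup∘tabulate _ u) (dec-true (p ℕ.≤? toℕ u) (outside-inject≤ p≤n u∉))
        F₀-large : ∀ i → Member F₀ i → p ≤ toℕ i
        F₀-large i F₀i with p ℕ.≤? toℕ i
        ... | yes p≤i = p≤i
        ... | no p≰i  = case ≡.trans (≡.sym F₀i) (≡.trans (lookup∘tabulate _ i) (dec-false (p ℕ.≤? toℕ i) p≰i)) of λ ()
        count₀ : ∣ F₀ ∣ + a < 2 * length L + ∣ ⊥ {n = n} ∣
        count₀ = ℕ.≤-<-trans (ℕ.+-monoˡ-≤ a (∣p∣≤n∸k p F₀ F₀-large))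
                   (≡.subst ((n ∸ p) + a <_) (≡.sym 2d+∣⊥∣≡2d) count)
          where
            2d+∣⊥∣≡2d : 2 * length L + ∣ ⊥ {n = n} ∣ ≡ 2 * length L
            2d+∣⊥∣≡2d = ≡.trans (cong (2 * length L +_) (∣⊥∣≡0 n)) (ℕ.+-identityʳ (2 * length L))

    reduced-in-ideal : ∀ {p D} (p≤n : p ≤ n) → (n ∸ p) + a < 2 * D →
                       ∀ {f} → Reduced (λ k → inject≤ k p≤n) D f → InIdeal n a f
    reduced-in-ideal p≤n count = go
      where
        go : ∀ {f} → Reduced (λ k → inject≤ k p≤n) _ f → InIdeal n a f
        go (gen (inj₁ I))                           = I₀⊆InIdeal I
        go (gen (inj₂ (outside-monomial refl L∉))) = outside-in-ideal p≤n _ count L∉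
        go span-0                                   = ideal-0
        go (span-+ S S′)                            = ideal-+ (go S) (go S′)
        go (span-neg S)                             = ideal-neg (go S)
        go (span-resp f≈g S)                        = ideal-resp f≈g (go S)

lemma5p7 : (n a : ℕ) → a ≤ n → 2 ∣ (n ∸ a) →
    (w : Fin n → Fin n) → IsInvolution w →
    (p : ℕ) → 1 ≤ p → (p≤n : p ≤ n) →
    n + a < p + 2 * twoCycles w →
    InIdeal n a (η· p p≤n (𝔪 w))
lemma5p7 n a _ _ w _ p _ p≤n n+a<p+2d =
  ≡.subst (InIdeal n a) (≡.sym η𝔪≡) (reduced-in-ideal a p≤n count (reduce (inject≤-injective p≤n p≤n _ _) pairs))
  where
    open Matrix n
    cycles : List (Fin n)
    cycles = filter (λ i → i <? w i) (allFin n)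
    pairs : List (Var n)
    pairs = map (λ i → (i , w i)) cycles

    η𝔪≡ : η· p p≤n (𝔪 w) ≡ symmetrize (λ k → inject≤ k p≤n) (monomial pairs)
    η𝔪≡ = ≡.trans (cong (η· p p≤n ∘ prodE) (List.map-∘ cycles)) (η·≡symmetrize p≤n _)

    count : (n ∸ p) + a < 2 * length pairs
    count = ℕ.+-cancelˡ-< p _ _ (≡.subst₂ _<_
              (≡.trans (cong (_+ a) (≡.sym (ℕ.m+[n∸m]≡n p≤n))) (ℕ.+-assoc p (n ∸ p) a))
              (cong (λ d → p + 2 * d) (≡.sym (List.length-map _ cycles)))
              n+a<p+2d)
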